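{- Let $w \in \mathfrak{S}_n$ and let $s = s_1 s_2 \cdots s_t$ be a reduced word of $w$ that is its own commutation class (equivalently, $|s_k - s_{k+1}| = 1$ for all $1 \le k < t$). Let $x < y$ be two letters appearing in $s$, and let $a < b$ be positions with $\{s_a, s_b\} = \{x,y\}$ such that no position strictly between $a$ and $b$ carries the value $x$ or $y$ (nearest instances of $x$ and $y$). Then the consecutive substring $s_a s_{a+1} \cdots s_b$ is a sequence of consecutive values from $x$ to $y$, i.e. it equals $x(x+1)\cdots y$ or $y(y-1)\cdots x$.
   Context: $\sigma_k$ ($1\le k\le n-1$) denotes the simple transposition of $\mathfrak{S}_n$ swapping $k$ and $k+1$, and $\ell(w)$ is the minimal number of simple transpositions whose product is $w$. A reduced word of $w$ is a word $a_1\cdots a_r$ on $\{1,\dots,n-1\}$ with $\sigma_{a_1}\cdots\sigma_{a_r}=w$ and $r=\ell(w)$. Two reduced words are commutation equivalent if they are related by a sequence of commutation moves $ij \leftrightarrow ji$ applied to adjacent letters with $|i-j|>1$. A reduced word is its own commutation class if no other reduced word is commutation equivalent to it; this holds exactly when every pair of adjacent letters differs by $1$. -}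

module Defs where

open import Data.Nat using (ℕ; zero; suc; _+_; _∸_; _≤_; _<_; ∣_-_∣)
open import Data.Nat.Base using (_≡ᵇ_)
open import Data.Bool using (if_then_else_)
open import Data.List using (List; []; _∷_; length; applyUpTo; reverse; take; drop)
open import Data.List.Relation.Unary.All using (All)
open import Data.Fin using (Fin; toℕ)
open import Data.Fin.Permutation using (Permutation′; _⟨$⟩ʳ_)
open import Data.Product using (_×_)
open import Relation.Binary.PropositionalEquality using (_≡_)
open import Relation.Binary.Construct.Closure.ReflexiveTransitive using (Star)

-- Values of S_n are 1..n (encoded as naturals).
-- The simple transposition σ_k acting on ℕ: swaps k and k+1, fixes all else.
σ : ℕ → ℕ → ℕ
σ k m = if m ≡ᵇ k then suc k else (if m ≡ᵇ suc k then k else m)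

prod : List ℕ → ℕ → ℕ
prod []       m = m
prod (a ∷ as) m = σ a (prod as m)

Letter : ℕ → ℕ → Set
Letter n a = (1 ≤ a) × (suc a ≤ n)

-- a word on {1..n-1} whose product is w ∈ S_n  (w acts on Fin n ≅ {1..n} via i ↦ i+1)
IsWordOf : (n : ℕ) → Permutation′ n → List ℕ → Set
IsWordOf n w u = All (Letter n) u × ((i : Fin n) → prod u (suc (toℕ i)) ≡ suc (toℕ (w ⟨$⟩ʳ i)))

IsReducedWordOf : (n : ℕ) → Permutation′ n → List ℕ → Set
IsReducedWordOf n w s = IsWordOf n w s × ((u : List ℕ) → IsWordOf n w u → length s ≤ length u)

data CommMove : List ℕ → List ℕ → Set where
  here  : ∀ {i j u} → 1 < ∣ i - j ∣ → CommMove (i ∷ j ∷ u) (j ∷ i ∷ u)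
  there : ∀ {a u v} → CommMove u v → CommMove (a ∷ u) (a ∷ v)

CommEquiv : List ℕ → List ℕ → Set
CommEquiv = Star CommMove

OwnCommClass : List ℕ → Set
OwnCommClass s = (u : List ℕ) → CommEquiv s u → u ≡ s

ascending : ℕ → ℕ → List ℕ
ascending x y = applyUpTo (x +_) (suc (y ∸ x))

descending : ℕ → ℕ → List ℕ
descending x y = reverse (ascending x y)

-- consecutive substring s_a ⋯ s_b (0-indexed positions, inclusive)
slice : ℕ → ℕ → List ℕ → List ℕ
slice a b s = take (suc (b ∸ a)) (drop a s)

-- In a reduced word that is its own commutation class, adjacent letters differ by exactly one:
-- equal neighbours would cancel and distant ones would commute.  So s_a ⋯ s_b is a walk with
-- steps ±1 from one of x, y to the other that meets neither of them in between; reversing the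
-- word if necessary (the reverse of a reduced word is reduced), it goes from x up to y and stays
-- strictly above x.  If it is not x (x+1) ⋯ y, it climbs x ⋯ m, turns down, and has to come back
-- to m before reaching y, everything in between lying in (x, m).  But
-- σ_x ⋯ σ_m W σ_m = W⁺ σ_x ⋯ σ_{m-1}, where W⁺ raises every letter of W by one, since
-- σ_x ⋯ σ_m conjugates σ_j into σ_{j+1}; this is a strictly shorter word for the same product.

module Submission where

open import Defs
open import Data.Bool using (true; false)
open import Data.Empty using (⊥-elim)
open import Data.Fin as F using (Fin; toℕ)
open import Data.Fin.Permutation using (Permutation′)
open import Data.List
  using (List; []; _∷_; _++_; _ʳ++_; [_]; _∷ʳ_; length; lookup; map; reverse; take; drop; applyUpTo)
open import Data.List.Membership.Propositional using (_∈_)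
open import Data.List.Properties
  using (++-assoc; length-++; length-map; length-reverse; reverse-involutive; reverse-++;
         unfold-reverse; take++drop≡id; applyUpTo-∷ʳ; ∷-injectiveˡ; ∷-injectiveʳ)
open import Data.List.Relation.Unary.All as All using (All; []; _∷_)
open import Data.List.Relation.Unary.All.Properties using (++⁺; ++⁻ˡ; ++⁻ʳ; map⁺)
open import Data.List.Relation.Unary.Any as Any using (Any; here; there)
import Data.List.Relation.Unary.Any.Properties as Anyₚ
open import Data.List.Relation.Unary.Linked as Linked using (Linked; []; [-]; _∷_)
open import Data.Nat
  using (ℕ; zero; suc; _+_; _∸_; _≤_; _<_; ∣_-_∣; _≡ᵇ_; z≤n; s≤s; s≤s⁻¹; _≤?_; _<?_; _≟_)
open import Data.Nat.Properties
open import Data.Product using (_×_; ∃; ∃₂; _,_; proj₁; proj₂)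
open import Data.Sum as Sum using (_⊎_; inj₁; inj₂)
open import Function using (_∘_)
open import Relation.Binary.Core using (Rel)
open import Relation.Binary.Definitions using (Symmetric)
open import Relation.Binary.PropositionalEquality
  using (_≡_; _≢_; _≗_; refl; sym; trans; cong; cong₂; subst; subst₂; ≢-sym; module ≡-Reasoning)
open import Relation.Binary.Construct.Closure.ReflexiveTransitive using (ε; _◅_; gmap)
open import Relation.Nullary using (¬_; yes; no)

open ≡-Reasoning

-- σ commutes with the shift m ↦ m + 1, so each Coxeter relation reduces to the case where
-- the letter or the point is 0, and there it holds by computation.
σ-shift : ∀ k m → σ (suc k) (suc m) ≡ suc (σ k m)
σ-shift k m with m ≡ᵇ k
... | true = refl
... | false with m ≡ᵇ suc k
...   | true  = refl
...   | false = refl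

σ-involutive : ∀ k m → σ k (σ k m) ≡ m
σ-involutive zero    zero          = refl
σ-involutive zero    (suc zero)    = refl
σ-involutive zero    (suc (suc m)) = refl
σ-involutive (suc k) zero          = refl
σ-involutive (suc k) (suc m)
  rewrite σ-shift k m | σ-shift k (σ k m) = cong suc (σ-involutive k m)

σ-comm : ∀ {a b} → suc a < b → ∀ m → σ a (σ b m) ≡ σ b (σ a m)
σ-comm {zero}  (s≤s (s≤s _)) zero          = refl
σ-comm {zero}  (s≤s (s≤s _)) (suc zero)    = refl
σ-comm {zero}  {suc (suc b)} (s≤s (s≤s _)) (suc (suc m))
  rewrite σ-shift (suc b) (suc m) | σ-shift b m = refl
σ-comm {suc a} (s≤s (s≤s _)) zero = refl
σ-comm {suc a} {suc (suc b)} (s≤s (s≤s a<b)) (suc m)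
  rewrite σ-shift (suc b) m | σ-shift a m | σ-shift a (σ (suc b) m) | σ-shift (suc b) (σ a m)
  = cong suc (σ-comm (s≤s a<b) m)

σ-braid : ∀ k m → σ k (σ (suc k) (σ k m)) ≡ σ (suc k) (σ k (σ (suc k) m))
σ-braid zero    zero                = refl
σ-braid zero    (suc zero)          = refl
σ-braid zero    (suc (suc zero))    = refl
σ-braid zero    (suc (suc (suc m))) = refl
σ-braid (suc k) zero                = refl
σ-braid (suc k) (suc m)
  rewrite σ-shift k m | σ-shift (suc k) (σ k m) | σ-shift k (σ (suc k) (σ k m))
        | σ-shift (suc k) m | σ-shift k (σ (suc k) m) | σ-shift (suc k) (σ k (σ (suc k) m))
  = cong suc (σ-braid k m)

prod-++ : ∀ u v m → prod (u ++ v) m ≡ prod u (prod v m)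
prod-++ []      v m = refl
prod-++ (a ∷ u) v m = cong (σ a) (prod-++ u v m)

prod-reverse-inverse : ∀ u m → prod (reverse u) (prod u m) ≡ m
prod-reverse-inverse []      m = refl
prod-reverse-inverse (a ∷ u) m = begin
  prod (reverse (a ∷ u)) (σ a (prod u m))
    ≡⟨ cong (λ v → prod v (σ a (prod u m))) (unfold-reverse a u) ⟩
  prod (reverse u ∷ʳ a) (σ a (prod u m))   ≡⟨ prod-++ (reverse u) [ a ] _ ⟩
  prod (reverse u) (σ a (σ a (prod u m)))  ≡⟨ cong (prod (reverse u)) (σ-involutive a _) ⟩
  prod (reverse u) (prod u m)              ≡⟨ prod-reverse-inverse u m ⟩
  m                                        ∎

prod-reverse-cong : ∀ {u v} → prod u ≗ prod v → prod (reverse u) ≗ prod (reverse v)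
prod-reverse-cong {u} {v} u≗v m = begin
  prod (reverse u) m                              ≡⟨ cong (prod (reverse u)) (sym v∘v⁻¹) ⟩
  prod (reverse u) (prod v (prod (reverse v) m))  ≡⟨ cong (prod (reverse u)) (sym (u≗v _)) ⟩
  prod (reverse u) (prod u (prod (reverse v) m))  ≡⟨ prod-reverse-inverse u _ ⟩
  prod (reverse v) m                              ∎
  where
  v∘v⁻¹ : prod v (prod (reverse v) m) ≡ m
  v∘v⁻¹ = subst (λ w → prod w (prod (reverse v) m) ≡ m) (reverse-involutive v)
                (prod-reverse-inverse (reverse v) m)

all-reverse : ∀ {P : ℕ → Set} {xs} → All P xs → All P (reverse xs)
all-reverse ps = All.tabulate (All.lookup ps ∘ Anyₚ.reverse⁻)

IsReduced : ℕ → List ℕ → Set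
IsReduced n t = All (Letter n) t × (∀ u → All (Letter n) u → prod u ≗ prod t → length t ≤ length u)

reducedWordOf⇒reduced : ∀ {n w s} → IsReducedWordOf n w s → IsReduced n s
reducedWordOf⇒reduced ((letters , represents) , shortest) =
  letters , λ u u-letters u≗s → shortest u (u-letters , λ i → trans (u≗s _) (represents i))

reduced-++⁻ʳ : ∀ {n} p {t} → IsReduced n (p ++ t) → IsReduced n t
reduced-++⁻ʳ p {t} (letters , shortest) = ++⁻ʳ p letters , λ u u-letters u≗t →
  +-cancelˡ-≤ (length p) _ _ (subst₂ _≤_ (length-++ p) (length-++ p)
    (shortest (p ++ u) (++⁺ (++⁻ˡ p letters) u-letters) λ m → begin
      prod (p ++ u) m    ≡⟨ prod-++ p u m ⟩
      prod p (prod u m)  ≡⟨ cong (prod p) (u≗t m) ⟩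
      prod p (prod t m)  ≡⟨ prod-++ p t m ⟨
      prod (p ++ t) m    ∎))

reduced-++⁻ˡ : ∀ {n} t {q} → IsReduced n (t ++ q) → IsReduced n t
reduced-++⁻ˡ t {q} (letters , shortest) = ++⁻ˡ t letters , λ u u-letters u≗t →
  +-cancelʳ-≤ (length q) _ _ (subst₂ _≤_ (length-++ t) (length-++ u)
    (shortest (u ++ q) (++⁺ u-letters (++⁻ʳ t letters)) λ m → begin
      prod (u ++ q) m    ≡⟨ prod-++ u q m ⟩
      prod u (prod q m)  ≡⟨ u≗t (prod q m) ⟩
      prod t (prod q m)  ≡⟨ prod-++ t q m ⟨
      prod (t ++ q) m    ∎))

reduced-reverse : ∀ {n t} → IsReduced n t → IsReduced n (reverse t)
reduced-reverse {t = t} (letters , shortest) = all-reverse letters , λ u u-letters u≗t⁻¹ →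
  subst₂ _≤_ (sym (length-reverse t)) (length-reverse u)
    (shortest (reverse u) (all-reverse u-letters) λ m →
      trans (prod-reverse-cong {u} {reverse t} u≗t⁻¹ m)
            (cong (λ v → prod v m) (reverse-involutive t)))

cancelling-pair-not-reduced : ∀ {n} a → ¬ IsReduced n (a ∷ a ∷ [])
cancelling-pair-not-reduced a (_ , shortest)
  with () ← shortest [] [] (λ m → sym (σ-involutive a m))

ascent : ℕ → ℕ → List ℕ
ascent x zero    = x ∷ []
ascent x (suc k) = x ∷ ascent (suc x) k

ascent-∷ʳ : ∀ x k → ascent x k ∷ʳ (x + suc k) ≡ ascent x (suc k)
ascent-∷ʳ x zero    = cong (λ v → x ∷ [ v ]) (+-comm x 1)
ascent-∷ʳ x (suc k) =
  cong (x ∷_) (trans (cong (ascent (suc x) k ∷ʳ_) (+-suc x (suc k))) (ascent-∷ʳ (suc x) k))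

ascent≡applyUpTo : ∀ x k → ascent x k ≡ applyUpTo (x +_) (suc k)
ascent≡applyUpTo x zero    = cong [_] (sym (+-identityʳ x))
ascent≡applyUpTo x (suc k) = begin
  ascent x (suc k)                             ≡⟨ ascent-∷ʳ x k ⟨
  ascent x k ∷ʳ (x + suc k)                    ≡⟨ cong (_∷ʳ (x + suc k)) (ascent≡applyUpTo x k) ⟩
  applyUpTo (x +_) (suc k) ∷ʳ (x + suc k)      ≡⟨ applyUpTo-∷ʳ (x +_) (suc k) ⟩
  applyUpTo (x +_) (suc (suc k))               ∎

length-ascent : ∀ x k → length (ascent x k) ≡ suc k
length-ascent x zero    = refl
length-ascent x (suc k) = cong suc (length-ascent (suc x) k)

ascent-lower-bound : ∀ x k → All (x ≤_) (ascent x k)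
ascent-lower-bound x zero    = ≤-refl ∷ []
ascent-lower-bound x (suc k) = ≤-refl ∷ All.map <⇒≤ (ascent-lower-bound (suc x) k)

σ-comm-prod : ∀ {a} u m → All (suc a <_) u → prod u (σ a m) ≡ σ a (prod u m)
σ-comm-prod []      m []             = refl
σ-comm-prod {a} (b ∷ u) m (a<b ∷ a<u) = begin
  σ b (prod u (σ a m))  ≡⟨ cong (σ b) (σ-comm-prod u m a<u) ⟩
  σ b (σ a (prod u m))  ≡⟨ σ-comm a<b (prod u m) ⟨
  σ a (σ b (prod u m))  ∎

ascent-conjugate : ∀ x k {j} m → x ≤ j → j < x + k →
                   prod (ascent x k) (σ j m) ≡ σ (suc j) (prod (ascent x k) m)
ascent-conjugate x zero    m x≤j j<x+0 = ⊥-elim (<⇒≱ (subst (_ <_) (+-identityʳ x) j<x+0) x≤j)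
ascent-conjugate x (suc k) {j} m x≤j j<x+k with x ≟ j
... | yes refl = conjugate-first k
  where
  conjugate-first : ∀ k → σ x (prod (ascent (suc x) k) (σ x m))
                          ≡ σ (suc x) (σ x (prod (ascent (suc x) k) m))
  conjugate-first zero    = σ-braid x m
  conjugate-first (suc k) = begin
    σ x (σ (suc x) (prod (ascent (suc (suc x)) k) (σ x m)))
      ≡⟨ cong (σ x ∘ σ (suc x)) (σ-comm-prod _ m (ascent-lower-bound (suc (suc x)) k)) ⟩
    σ x (σ (suc x) (σ x (prod (ascent (suc (suc x)) k) m)))
      ≡⟨ σ-braid x (prod (ascent (suc (suc x)) k) m) ⟩
    σ (suc x) (σ x (σ (suc x) (prod (ascent (suc (suc x)) k) m)))  ∎
... | no x≢j = begin
  σ x (prod (ascent (suc x) k) (σ j m))   ≡⟨ cong (σ x) (ascent-conjugate (suc x) k m x<j j<1+x+k) ⟩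
  σ x (σ (suc j) (prod (ascent (suc x) k) m)) ≡⟨ σ-comm (s≤s x<j) (prod (ascent (suc x) k) m) ⟩
  σ (suc j) (σ x (prod (ascent (suc x) k) m)) ∎
  where
  x<j : x < j
  x<j = ≤∧≢⇒< x≤j x≢j
  j<1+x+k : j < suc x + k
  j<1+x+k = subst (j <_) (+-suc x k) j<x+k

ascent-conjugate-word : ∀ x k w m → All (λ c → x ≤ c × c < x + k) w →
                        prod (ascent x k) (prod w m) ≡ prod (map suc w) (prod (ascent x k) m)
ascent-conjugate-word x k []      m []                  = refl
ascent-conjugate-word x k (c ∷ w) m ((x≤c , c<x+k) ∷ w-bounds) = begin
  prod (ascent x k) (σ c (prod w m))
    ≡⟨ ascent-conjugate x k (prod w m) x≤c c<x+k ⟩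
  σ (suc c) (prod (ascent x k) (prod w m))
    ≡⟨ cong (σ (suc c)) (ascent-conjugate-word x k w m w-bounds) ⟩
  σ (suc c) (prod (map suc w) (prod (ascent x k) m))  ∎

peak-identity : ∀ x k w → All (λ c → x ≤ c × c < x + suc k) w →
                prod (ascent x (suc k) ++ w ++ [ x + suc k ]) ≗ prod (map suc w ++ ascent x k)
peak-identity x k w w-bounds m = begin
  prod (ascent x (suc k) ++ w ++ [ top ]) m
    ≡⟨ prod-++ (ascent x (suc k)) _ m ⟩
  prod (ascent x (suc k)) (prod (w ++ [ top ]) m)
    ≡⟨ cong (prod (ascent x (suc k))) (prod-++ w [ top ] m) ⟩
  prod (ascent x (suc k)) (prod w (σ top m))
    ≡⟨ ascent-conjugate-word x (suc k) w (σ top m) w-bounds ⟩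
  prod (map suc w) (prod (ascent x (suc k)) (σ top m))
    ≡⟨ cong (λ v → prod (map suc w) (prod v (σ top m))) (ascent-∷ʳ x k) ⟨
  prod (map suc w) (prod (ascent x k ∷ʳ top) (σ top m))
    ≡⟨ cong (prod (map suc w)) (prod-++ (ascent x k) [ top ] (σ top m)) ⟩
  prod (map suc w) (prod (ascent x k) (σ top (σ top m)))
    ≡⟨ cong (prod (map suc w) ∘ prod (ascent x k)) (σ-involutive top m) ⟩
  prod (map suc w) (prod (ascent x k) m)
    ≡⟨ prod-++ (map suc w) (ascent x k) m ⟨
  prod (map suc w ++ ascent x k) m  ∎
  where
  top = x + suc k

peak-not-reduced : ∀ {n} x k w → All (λ c → x ≤ c × c < x + suc k) w →
                   ¬ IsReduced n (ascent x (suc k) ++ w ++ [ x + suc k ])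
peak-not-reduced {n} x k w w-bounds (letters , shortest) =
  1+n≰n (≤-trans (n≤1+n _) (subst₂ _≤_ longer shorter
    (shortest (map suc w ++ ascent x k) (++⁺ raised-letters ascent-letters)
      (sym ∘ peak-identity x k w w-bounds))))
  where
  top-letter : Letter n (x + suc k)
  top-letter with ++⁻ʳ w (++⁻ʳ (ascent x (suc k)) letters)
  ... | top-letter ∷ [] = top-letter
  ascent-letters : All (Letter n) (ascent x k)
  ascent-letters = ++⁻ˡ (ascent x k)
    (subst (All (Letter n)) (sym (ascent-∷ʳ x k)) (++⁻ˡ (ascent x (suc k)) letters))
  raised-letters : All (Letter n) (map suc w)
  raised-letters =
    map⁺ (All.map (λ (_ , c<top) → s≤s z≤n , ≤-trans (s≤s c<top) (proj₂ top-letter)) w-bounds)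
  longer : length (ascent x (suc k) ++ w ++ [ x + suc k ]) ≡ 2 + (length w + suc k)
  longer = begin
    length (ascent x (suc k) ++ w ++ [ x + suc k ])  ≡⟨ length-++ (ascent x (suc k)) ⟩
    length (ascent x (suc k)) + length (w ++ [ x + suc k ])
      ≡⟨ cong₂ _+_ (length-ascent x (suc k)) (length-++ w) ⟩
    suc (suc k) + (length w + 1)
      ≡⟨ cong (2 +_) (trans (+-comm k (length w + 1)) (+-assoc (length w) 1 k)) ⟩
    2 + (length w + suc k)                           ∎
  shorter : length (map suc w ++ ascent x k) ≡ length w + suc k
  shorter = trans (length-++ (map suc w)) (cong₂ _+_ (length-map suc w) (length-ascent x k))

Neighbours : ℕ → ℕ → Set
Neighbours i j = j ≡ suc i ⊎ i ≡ suc j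

neighbours-sym : Symmetric Neighbours
neighbours-sym = Sum.swap

neighbour-≤ : ∀ {i j} → Neighbours i j → j ≤ suc i
neighbour-≤ (inj₁ refl) = ≤-refl
neighbour-≤ (inj₂ refl) = ≤-trans (n≤1+n _) (n≤1+n _)

distance-one⇒neighbours : ∀ i j → ∣ i - j ∣ ≡ 1 → Neighbours i j
distance-one⇒neighbours zero    j       refl = inj₁ refl
distance-one⇒neighbours (suc i) zero    refl = inj₂ refl
distance-one⇒neighbours (suc i) (suc j) d    =
  Sum.map (cong suc) (cong suc) (distance-one⇒neighbours i j d)

module _ {a ℓ} {A : Set a} {R : Rel A ℓ} where

  linked-++⁻ˡ : ∀ xs {ys} → Linked R (xs ++ ys) → Linked R xs
  linked-++⁻ˡ []           _         = []
  linked-++⁻ˡ (x ∷ [])     _         = [-]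
  linked-++⁻ˡ (x ∷ y ∷ xs) (r ∷ rs) = r ∷ linked-++⁻ˡ (y ∷ xs) rs

  linked-++⁻ʳ : ∀ xs {ys} → Linked R (xs ++ ys) → Linked R ys
  linked-++⁻ʳ []       rs = rs
  linked-++⁻ʳ (x ∷ xs) rs = linked-++⁻ʳ xs (Linked.tail rs)

  linked-reverse : Symmetric R → ∀ {xs} → Linked R xs → Linked R (reverse xs)
  linked-reverse sym-R {[]}     _  = []
  linked-reverse sym-R {x ∷ xs} rs = reverse-onto x xs [] rs [-]
    where
    reverse-onto : ∀ x xs ys → Linked R (x ∷ xs) → Linked R (x ∷ ys) → Linked R (xs ʳ++ x ∷ ys)
    reverse-onto x []       ys _        rs′ = rs′
    reverse-onto x (y ∷ xs) ys (r ∷ rs) rs′ = reverse-onto y xs (x ∷ ys) rs (sym-R r ∷ rs′)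

ownCommClass-tail : ∀ {a s} → OwnCommClass (a ∷ s) → OwnCommClass s
ownCommClass-tail {a} own u s~u = ∷-injectiveʳ (own (a ∷ u) (gmap (a ∷_) there s~u))

ownCommClass⇒linked : ∀ {n s} → IsReduced n s → OwnCommClass s → Linked Neighbours s
ownCommClass⇒linked {s = []}        _   _   = []
ownCommClass⇒linked {s = i ∷ []}    _   _   = [-]
ownCommClass⇒linked {s = i ∷ j ∷ s} red own =
  adjacent ∷ ownCommClass⇒linked (reduced-++⁻ʳ (i ∷ []) red) (ownCommClass-tail own)
  where
  adjacent : Neighbours i j
  adjacent with ∣ i - j ∣ in d
  ... | zero with refl ← ∣m-n∣≡0⇒m≡n {i} {j} d =
    ⊥-elim (cancelling-pair-not-reduced i (reduced-++⁻ˡ (i ∷ i ∷ []) red))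
  ... | suc zero = distance-one⇒neighbours i j d
  ... | suc (suc _)
    with refl ← ∷-injectiveˡ (own (j ∷ i ∷ s) (here (subst (1 <_) (sym d) (s≤s (s≤s z≤n))) ◅ ε))
    with () ← trans (sym d) (∣n-n∣≡0 i)

stays-above : ∀ {x h r} → x < h → Linked Neighbours (h ∷ r) → All (_≢ x) r → All (x <_) r
stays-above x<h [-]            []                = []
stays-above {x} {r = h′ ∷ _} x<h (h~h′ ∷ walk) (h′≢x ∷ r≢x) = x<h′ ∷ stays-above x<h′ walk r≢x
  where
  x<h′ : x < h′
  x<h′ = ≤∧≢⇒< (s≤s⁻¹ (≤-trans x<h (neighbour-≤ (neighbours-sym h~h′)))) (≢-sym h′≢x)

first-visit : ∀ {m h r} → h < m → Linked Neighbours (h ∷ r) → Any (m ≤_) r →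
              ∃₂ λ w rest → h ∷ r ≡ w ++ m ∷ rest × All (_< m) w
first-visit {m} {h} {h′ ∷ r} h<m (h~h′ ∷ walk) m≤r with m ≤? h′
... | yes m≤h′ with refl ← ≤-antisym (≤-trans (neighbour-≤ h~h′) h<m) m≤h′ =
  [ h ] , r , refl , h<m ∷ []
... | no m≰h′ with m≤r
...   | here m≤h′ = ⊥-elim (m≰h′ m≤h′)
...   | there m≤r′ with first-visit (≰⇒> m≰h′) walk m≤r′
...     | w , rest , h′∷r≡ , w<m = h ∷ w , rest , cong (h ∷_) h′∷r≡ , h<m ∷ w<m

avoiding-walk-stays-above : ∀ {x r} → Linked Neighbours r → All (_≢ x) r → Any (x <_) r →
                            All (x <_) r
avoiding-walk-stays-above {x} {h ∷ r} walk (h≢x ∷ r≢x) x<r with x <? h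
... | yes x<h = x<h ∷ stays-above x<h walk r≢x
... | no x≮h with x<r
...   | here x<h = ⊥-elim (x≮h x<h)
...   | there x<r′ with first-visit (≤∧≢⇒< (≮⇒≥ x≮h) h≢x) walk (Any.map <⇒≤ x<r′)
...     | w , rest , h∷r≡ , _ with ++⁻ʳ w (subst (All (_≢ x)) h∷r≡ (h≢x ∷ r≢x))
...       | x≢x ∷ _ = ⊥-elim (x≢x refl)

-- The walk has climbed x, x+1, …, x+k so far.  If it ever turns down, it has to come back to the
-- peak x+k before reaching y, which produces a factor ruled out by peak-not-reduced.
climb : ∀ {n x y} k mid → IsReduced n (ascent x k ++ mid ++ [ y ]) →
        Linked Neighbours (x + k ∷ mid ++ [ y ]) → All (x <_) (mid ++ [ y ]) → All (_≢ y) mid →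
        x + k < y → ascent x k ++ mid ++ [ y ] ≡ ascent x (y ∸ x)
climb {x = x} {y} k [] _ (y≡ ∷ [-]) _ _ top<y with y≡
... | inj₂ top≡ = ⊥-elim (<-asym top<y (subst (y <_) (sym top≡) (n<1+n y)))
... | inj₁ refl = begin
  ascent x k ++ [ suc (x + k) ]   ≡⟨ cong (λ v → ascent x k ∷ʳ v) (+-suc x k) ⟨
  ascent x k ∷ʳ (x + suc k)       ≡⟨ ascent-∷ʳ x k ⟩
  ascent x (suc k)                ≡⟨ cong (ascent x) (m+n∸m≡n x (suc k)) ⟨
  ascent x (x + suc k ∸ x)        ≡⟨ cong (λ v → ascent x (v ∸ x)) (+-suc x k) ⟩
  ascent x (suc (x + k) ∸ x)      ∎
climb {n} {x} {y} k (h ∷ mid) red (inj₁ h≡ ∷ walk) (_ ∷ above) (h≢y ∷ avoids) top<y =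
  trans regroup (climb (suc k) mid (subst (IsReduced n) regroup red) walk′ above avoids h<y)
  where
  h≡′ : h ≡ x + suc k
  h≡′ = trans h≡ (sym (+-suc x k))
  regroup : ascent x k ++ h ∷ mid ++ [ y ] ≡ ascent x (suc k) ++ mid ++ [ y ]
  regroup = begin
    ascent x k ++ h ∷ mid ++ [ y ]            ≡⟨ ++-assoc (ascent x k) [ h ] _ ⟨
    (ascent x k ∷ʳ h) ++ mid ++ [ y ]         ≡⟨ cong (λ v → (ascent x k ∷ʳ v) ++ mid ++ [ y ]) h≡′ ⟩
    (ascent x k ∷ʳ (x + suc k)) ++ mid ++ [ y ] ≡⟨ cong (_++ mid ++ [ y ]) (ascent-∷ʳ x k) ⟩
    ascent x (suc k) ++ mid ++ [ y ]          ∎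
  walk′ : Linked Neighbours (x + suc k ∷ mid ++ [ y ])
  walk′ = subst (λ v → Linked Neighbours (v ∷ mid ++ [ y ])) h≡′ walk
  h<y : x + suc k < y
  h<y = subst (_< y) h≡′ (≤∧≢⇒< (subst (_≤ y) (sym h≡) top<y) h≢y)
climb {x = x} zero (h ∷ mid) _ (inj₂ x+0≡ ∷ _) (x<h ∷ _) _ _ =
  ⊥-elim (<-asym x<h (subst (h <_) (trans (sym x+0≡) (+-identityʳ x)) (n<1+n h)))
climb {x = x} (suc zero) (h ∷ mid) _ (inj₂ x+1≡ ∷ _) (x<h ∷ _) _ _ =
  ⊥-elim (<-irrefl (suc-injective (trans (+-comm 1 x) x+1≡)) x<h)
climb {n} {x} {y} k@(suc k′@(suc _)) (h ∷ mid) red (inj₂ top≡ ∷ walk) above _ top<y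
  with first-visit (≤-reflexive (sym top≡)) walk (Anyₚ.++⁺ʳ mid (here (<⇒≤ top<y)))
... | w , rest , h∷r≡ , w<top = ⊥-elim (peak-not-reduced x k′ w w-bounds peak-reduced)
  where
  x<w : All (x <_) w
  x<w = ++⁻ˡ w (subst (All (x <_)) h∷r≡ above)
  w-bounds : All (λ c → x ≤ c × c < x + k) w
  w-bounds = All.zip (All.map <⇒≤ x<w , w<top)
  peak-reduced : IsReduced n (ascent x k ++ w ++ [ x + k ])
  peak-reduced = reduced-++⁻ˡ (ascent x k ++ w ++ [ x + k ]) (subst (IsReduced n) (begin
    ascent x k ++ h ∷ mid ++ [ y ]        ≡⟨ cong (ascent x k ++_) h∷r≡ ⟩
    ascent x k ++ w ++ x + k ∷ rest       ≡⟨ cong (ascent x k ++_) (++-assoc w [ x + k ] rest) ⟨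
    ascent x k ++ (w ++ [ x + k ]) ++ rest ≡⟨ ++-assoc (ascent x k) (w ++ [ x + k ]) rest ⟨
    (ascent x k ++ w ++ [ x + k ]) ++ rest ∎) red)

ascending-walk : ∀ {n x y} mid → x < y → All (λ c → c ≢ x × c ≢ y) mid →
                 IsReduced n (x ∷ mid ++ [ y ]) → Linked Neighbours (x ∷ mid ++ [ y ]) →
                 x ∷ mid ++ [ y ] ≡ ascending x y
ascending-walk {x = x} {y} mid x<y avoids red walk = begin
  x ∷ mid ++ [ y ]  ≡⟨ climb 0 mid red walk′ above (All.map proj₂ avoids) x+0<y ⟩
  ascent x (y ∸ x)  ≡⟨ ascent≡applyUpTo x (y ∸ x) ⟩
  ascending x y     ∎
  where
  walk′ : Linked Neighbours (x + 0 ∷ mid ++ [ y ])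
  walk′ = subst (λ v → Linked Neighbours (v ∷ mid ++ [ y ])) (sym (+-identityʳ x)) walk
  x+0<y : x + 0 < y
  x+0<y = subst (_< y) (sym (+-identityʳ x)) x<y
  above : All (x <_) (mid ++ [ y ])
  above = avoiding-walk-stays-above (linked-++⁻ʳ [ x ] walk)
    (++⁺ (All.map proj₁ avoids) (≢-sym (<⇒≢ x<y) ∷ [])) (Anyₚ.++⁺ʳ mid (here x<y))

reverse-between : ∀ (u : ℕ) mid v → reverse (u ∷ mid ++ [ v ]) ≡ v ∷ reverse mid ++ [ u ]
reverse-between u mid v =
  trans (unfold-reverse u (mid ++ [ v ])) (cong (_∷ʳ u) (reverse-++ mid [ v ]))

monotone-walk : ∀ {n x y u v} mid → x < y → All (λ c → c ≢ x × c ≢ y) mid →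
                (u ≡ x × v ≡ y) ⊎ (u ≡ y × v ≡ x) →
                IsReduced n (u ∷ mid ++ [ v ]) → Linked Neighbours (u ∷ mid ++ [ v ]) →
                (u ∷ mid ++ [ v ] ≡ ascending x y) ⊎ (u ∷ mid ++ [ v ] ≡ descending x y)
monotone-walk mid x<y avoids (inj₁ (refl , refl)) red walk =
  inj₁ (ascending-walk mid x<y avoids red walk)
monotone-walk {n} {x} {y} mid x<y avoids (inj₂ (refl , refl)) red walk = inj₂ (begin
  y ∷ mid ++ [ x ]                      ≡⟨ reverse-involutive _ ⟨
  reverse (reverse (y ∷ mid ++ [ x ]))  ≡⟨ cong reverse (reverse-between y mid x) ⟩
  reverse (x ∷ reverse mid ++ [ y ])    ≡⟨ cong reverse (ascending-walk (reverse mid) x<y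
                                             (all-reverse avoids) red′ walk′) ⟩
  descending x y                        ∎)
  where
  red′ : IsReduced n (x ∷ reverse mid ++ [ y ])
  red′ = subst (IsReduced n) (reverse-between y mid x) (reduced-reverse red)
  walk′ : Linked Neighbours (x ∷ reverse mid ++ [ y ])
  walk′ = subst (Linked Neighbours) (reverse-between y mid x) (linked-reverse neighbours-sym walk)

take-interior : ∀ {P : ℕ → Set} (s : List ℕ) (b : Fin (length s)) →
                (∀ c → toℕ c < toℕ b → P (lookup s c)) →
                ∃ λ mid → take (suc (toℕ b)) s ≡ mid ++ [ lookup s b ] × All P mid
take-interior (e ∷ s) F.zero    _      = [] , refl , []
take-interior (e ∷ s) (F.suc b) before with take-interior s b (λ c → before (F.suc c) ∘ s≤s)
... | mid , take≡ , P-mid = e ∷ mid , cong (e ∷_) take≡ , before F.zero (s≤s z≤n) ∷ P-mid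

slice-interior : ∀ {P : ℕ → Set} (s : List ℕ) (a b : Fin (length s)) → toℕ a < toℕ b →
                 (∀ c → toℕ a < toℕ c → toℕ c < toℕ b → P (lookup s c)) →
                 ∃ λ mid → slice (toℕ a) (toℕ b) s ≡ lookup s a ∷ mid ++ [ lookup s b ] × All P mid
slice-interior (e ∷ s) F.zero (F.suc b) _ between
  with take-interior s b (λ c → between (F.suc c) (s≤s z≤n) ∘ s≤s)
... | mid , take≡ , P-mid = mid , cong (e ∷_) take≡ , P-mid
slice-interior (e ∷ s) (F.suc a) (F.suc b) (s≤s a<b) between =
  slice-interior s a b a<b (λ c a<c c<b → between (F.suc c) (s≤s a<c) (s≤s c<b))

slice-infix : ∀ a b (s : List ℕ) → take a s ++ slice a b s ++ drop (suc (b ∸ a)) (drop a s) ≡ s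
slice-infix a b s =
  trans (cong (take a s ++_) (take++drop≡id (suc (b ∸ a)) (drop a s))) (take++drop≡id a s)

corollary2p3 : (n : ℕ) (w : Permutation′ n) (s : List ℕ) →
    IsReducedWordOf n w s → OwnCommClass s →
    (x y : ℕ) → x < y → x ∈ s → y ∈ s →
    (a b : Fin (length s)) → toℕ a < toℕ b →
    ((lookup s a ≡ x × lookup s b ≡ y) ⊎ (lookup s a ≡ y × lookup s b ≡ x)) →
    ((c : Fin (length s)) → toℕ a < toℕ c → toℕ c < toℕ b →
      ¬ (lookup s c ≡ x) × ¬ (lookup s c ≡ y)) →
    (slice (toℕ a) (toℕ b) s ≡ ascending x y) ⊎ (slice (toℕ a) (toℕ b) s ≡ descending x y)
-- x ∈ s and y ∈ s are implied by the hypothesis on the endpoints.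
corollary2p3 n w s red own x y x<y _ _ a b a<b ends nearest
  with slice-interior s a b a<b nearest
... | mid , slice≡ , avoids =
  subst (λ t → (t ≡ ascending x y) ⊎ (t ≡ descending x y)) (sym slice≡)
    (monotone-walk mid x<y avoids ends (subst (IsReduced n) slice≡ slice-reduced)
                                       (subst (Linked Neighbours) slice≡ slice-linked))
  where
  s-reduced : IsReduced n s
  s-reduced = reducedWordOf⇒reduced {w = w} red
  prefix t suffix : List ℕ
  prefix = take (toℕ a) s
  t      = slice (toℕ a) (toℕ b) s
  suffix = drop (suc (toℕ b ∸ toℕ a)) (drop (toℕ a) s)
  s≡ : s ≡ prefix ++ t ++ suffix
  s≡ = sym (slice-infix (toℕ a) (toℕ b) s)
  slice-reduced : IsReduced n t
  slice-reduced = reduced-++⁻ˡ t (reduced-++⁻ʳ prefix (subst (IsReduced n) s≡ s-reduced))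
  slice-linked : Linked Neighbours t
  slice-linked = linked-++⁻ˡ t (linked-++⁻ʳ prefix
    (subst (Linked Neighbours) s≡ (ownCommClass⇒linked s-reduced own)))
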